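{- Let $n\ge 1$. Snort played on the (initially uncoloured, untinted) graph $T_{n,2}$ is a first player win, and Snort played on the (initially uncoloured, untinted) graph $T_{n,2}^{+}$ is a first player win. That is, on each of these graphs, whichever player moves first has a winning strategy.
   Context: Snort is a two-player game (players Left and Right) played on a finite simple graph. The players alternately colour a previously uncoloured vertex, Left in blue and Right in red, subject to the rule that no two adjacent vertices may receive opposite colours (a player may not colour a vertex adjacent to a vertex of the opponent's colour). Normal play: a player who cannot move on their turn loses (the player making the last move wins). A game is a "first player win" if the player who moves first has a winning strategy, regardless of whether that player is Left or Right. $T_{n,m}$ (the triangulated Cartesian product of paths $P_n$ and $P_m$) is the graph with vertex set $\{(i,j): 1\le i\le n,\ 1\le j\le m\}$ and edges $(i,j)\sim(i+1,j)$ for $1\le i\le n-1$, $1\le j\le m$; $(i,j)\sim(i,j+1)$ for $1\le i\le n$, $1\le j\le m-1$; and $(i,j)\sim(i+1,j+1)$ for $1\le i\le n-1$, $1\le j\le m-1$. $T_{n,2}^{+}$ is the graph obtained from $T_{n,2}$ by adding one new vertex $R_2$ together with the two edges $(n,1)\sim R_2$ and $(n,2)\sim R_2$. -}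

module Defs where

open import Data.Nat using (ℕ; suc)
open import Data.Fin using (Fin; toℕ)
open import Data.Product using (_×_; _,_)
open import Data.Sum using (_⊎_)
open import Data.Maybe using (Maybe; just; nothing)
open import Data.Empty using (⊥)
open import Relation.Nullary using (¬_; yes; no)
open import Relation.Binary.Definitions using (DecidableEquality)
open import Relation.Binary.PropositionalEquality using (_≡_; _≢_)
import Data.Fin.Properties as FinP
import Data.Product.Properties as ProdP
import Data.Maybe.Properties as MaybeP

-- Finite simple graphs (vertex type with decidable equality,
-- adjacency = symmetric closure of an irreflexive edge relation)

record Graph : Set₁ where
  field
    V    : Set
    _≟V_ : DecidableEquality V
    Adj  : V → V → Set

data Player : Set where
  Left Right : Player

opp : Player → Player
opp Left  = Right
opp Right = Left

-- uncoloured, or coloured by a player (Left = blue, Right = red)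
data Colour : Set where
  uncol : Colour
  col   : Player → Colour

module Snort (G : Graph) where
  open Graph G

  Position : Set
  Position = V → Colour

  initial : Position
  initial _ = uncol

  Legal : Player → Position → V → Set
  Legal p pos v = (pos v ≡ uncol) × (∀ w → Adj v w → pos w ≢ col (opp p))

  play : Position → V → Player → Position
  play pos v p w with w ≟V v
  ... | yes _ = col p
  ... | no  _ = pos w

  -- Win p pos  : player p, to move in pos, has a winning strategy
  -- Lose p pos : player p, to move in pos, loses against best play
  -- (normal play: a player with no legal move loses)
  data Win  : Player → Position → Set
  data Lose : Player → Position → Set

  data Win where
    win : ∀ {p pos} (v : V) → Legal p pos v →
          Lose (opp p) (play pos v p) → Win p pos

  data Lose where
    lose : ∀ {p pos} →
           (∀ (v : V) → Legal p pos v → Win (opp p) (play pos v p)) →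
           Lose p pos

  FirstPlayerWin : Set
  FirstPlayerWin = ∀ (p : Player) → Win p initial

FirstPlayerWin : Graph → Set
FirstPlayerWin G = Snort.FirstPlayerWin G

-- T_{n,m}: vertex (i,j) encoded as (i-1, j-1) ∈ Fin n × Fin m

TEdge : ∀ {n m} → Fin n × Fin m → Fin n × Fin m → Set
TEdge (i , j) (i' , j') =
    (toℕ i' ≡ suc (toℕ i) × j ≡ j')
  ⊎ (i ≡ i' × toℕ j' ≡ suc (toℕ j))
  ⊎ (toℕ i' ≡ suc (toℕ i) × toℕ j' ≡ suc (toℕ j))

T : ℕ → ℕ → Graph
T n m = record
  { V    = Fin n × Fin m
  ; _≟V_ = ProdP.≡-dec FinP._≟_ FinP._≟_
  ; Adj  = λ u v → TEdge u v ⊎ TEdge v u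
  }

-- T_{n,2}^+: extra vertex R₂ (= nothing) adjacent to (n,1) and (n,2)
TPlusEdge : ∀ n → Maybe (Fin n × Fin 2) → Maybe (Fin n × Fin 2) → Set
TPlusEdge n (just u)       (just v) = TEdge u v
TPlusEdge n (just (i , j)) nothing  = suc (toℕ i) ≡ n
TPlusEdge n nothing        _        = ⊥

TPlus : ℕ → Graph
TPlus n = record
  { V    = Maybe (Fin n × Fin 2)
  ; _≟V_ = MaybeP.≡-dec (ProdP.≡-dec FinP._≟_ FinP._≟_)
  ; Adj  = λ u v → TPlusEdge n u v ⊎ TPlusEdge n v u
  }

{-# OPTIONS --safe #-}
module Submission where

-- Numbering the vertices of the ladder T_{n,2} rung by rung, starting from the last rung, makes
-- two vertices adjacent exactly when their numbers differ by 1 or 2: T_{n,2} is the square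
-- P_{2n}² of a path, and T_{n,2}⁺ is P_{2n+1}² once R₂ is numbered 0.
--
-- On a path square the first player wins by symmetry. They colour a middle vertex c and answer
-- every opponent move at v by colouring the reflection v′ of v. Apart from c, the position stays
-- symmetric with the colours swapped, so v′ is still uncoloured, and a neighbour of v′ carrying
-- the opponent's colour would reflect to a neighbour of v carrying the first player's colour.
-- The answer could only fail when v′ is v, adjacent to v, or c; but then v is c or adjacent to
-- c, which the opponent can never play.

open import Defs
open import Data.Empty using (⊥-elim)
open import Data.Fin using (Fin; zero; suc; toℕ; opposite; combine; remQuot; fromℕ<)
open import Data.Fin.Properties
  using (toℕ-injective; toℕ<n; toℕ-fromℕ<; opposite-prop; opposite-involutive;
         toℕ-combine; combine-remQuot; remQuot-combine)
  renaming (_≟_ to _≟ᶠ_)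
open import Data.List using (List; []; _∷_; map; allFin)
open import Data.List.Membership.Propositional using (_∈_)
open import Data.List.Membership.Propositional.Properties using (∈-allFin; ∈-map⁺)
open import Data.List.Relation.Unary.Any using (here; there)
open import Data.Maybe using (Maybe; just; nothing)
open import Data.Nat
  using (ℕ; zero; suc; _+_; _*_; _∸_; _≤_; _<_; _≥_; z≤n; s≤s; ⌊_/2⌋; ⌈_/2⌉)
open import Data.Nat.Induction using (<-wellFounded)
open import Data.Nat.Properties
open import Data.Product using (_×_; _,_; proj₁; proj₂; map₁)
open import Data.Sum using (_⊎_; inj₁; inj₂; [_,_]′)
  renaming (map to ⊎-map; map₁ to ⊎-map₁; map₂ to ⊎-map₂; swap to ⊎-swap)
open import Function using (_∘_)
open import Function.Bundles using (Inverse; _↔_; mk↔ₛ′)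
open import Induction.WellFounded using (Acc; acc)
open import Relation.Nullary using (¬_; Dec; yes; no)
open import Relation.Binary.PropositionalEquality
  using (_≡_; _≢_; refl; sym; trans; cong; subst; subst₂; module ≡-Reasoning)

opp-involutive : ∀ p → opp (opp p) ≡ p
opp-involutive Left  = refl
opp-involutive Right = refl

uncol≢col : ∀ {p} → uncol ≢ col p
uncol≢col ()

col≢col-opp : ∀ p → col p ≢ col (opp p)
col≢col-opp Left  ()
col≢col-opp Right ()

colour-cases : ∀ p c → c ≡ uncol ⊎ c ≡ col p ⊎ c ≡ col (opp p)
colour-cases _     uncol       = inj₁ refl
colour-cases Left  (col Left)  = inj₂ (inj₁ refl)
colour-cases Left  (col Right) = inj₂ (inj₂ refl)
colour-cases Right (col Left)  = inj₂ (inj₂ refl)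
colour-cases Right (col Right) = inj₂ (inj₁ refl)

-- The mirror strategy

module Mirror (G : Graph) where
  open Graph G
  open Snort G hiding (FirstPlayerWin)

  play-same : ∀ pos v p → play pos v p v ≡ col p
  play-same pos v p with v ≟V v
  ... | yes _  = refl
  ... | no v≢v = ⊥-elim (v≢v refl)

  play-other : ∀ pos v p {w} → w ≢ v → play pos v p w ≡ pos w
  play-other pos v p {w} w≢v with w ≟V v
  ... | yes w≡v = ⊥-elim (w≢v w≡v)
  ... | no _    = refl

  isUncol : Colour → ℕ
  isUncol uncol   = 1
  isUncol (col _) = 0

  uncoloured : List V → Position → ℕ
  uncoloured []       pos = 0
  uncoloured (u ∷ us) pos = isUncol (pos u) + uncoloured us pos

  isUncol-play : ∀ pos v p u → isUncol (play pos v p u) ≤ isUncol (pos u)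
  isUncol-play pos v p u with u ≟V v
  ... | yes _ = z≤n
  ... | no _  = ≤-refl

  uncoloured-play-≤ : ∀ us pos v p → uncoloured us (play pos v p) ≤ uncoloured us pos
  uncoloured-play-≤ []       pos v p = z≤n
  uncoloured-play-≤ (u ∷ us) pos v p =
    +-mono-≤ (isUncol-play pos v p u) (uncoloured-play-≤ us pos v p)

  uncoloured-play-< : ∀ {us pos v} p → v ∈ us → pos v ≡ uncol →
                      uncoloured us (play pos v p) < uncoloured us pos
  uncoloured-play-< {u ∷ us} {pos} {v} p (here refl) v-uncol
    rewrite play-same pos v p | v-uncol = s≤s (uncoloured-play-≤ us pos v p)
  uncoloured-play-< {u ∷ us} {pos} {v} p (there v∈us) v-uncol =
    +-mono-≤-< (isUncol-play pos v p u) (uncoloured-play-< p v∈us v-uncol)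

  _∈N[_] : V → V → Set
  v ∈N[ c ] = v ≡ c ⊎ Adj v c

  record MirrorStrategy : Set where
    field
      centre            : V
      mirror            : V → V
      mirror-involutive : ∀ v → mirror (mirror v) ≡ v
      mirror-adj        : ∀ {u v} → Adj u v → Adj (mirror u) (mirror v)
      near-mirror⇒∈N    : ∀ v → v ≡ mirror v ⊎ Adj v (mirror v) → v ∈N[ centre ]
      mirror-centre-∈N  : mirror centre ∈N[ centre ]
      vertices          : List V
      vertices-complete : ∀ v → v ∈ vertices

    mirror-injective : ∀ {u v} → mirror u ≡ mirror v → u ≡ v
    mirror-injective {u} {v} e =
      trans (sym (mirror-involutive u)) (trans (cong mirror e) (mirror-involutive v))

    mirror-adjˡ : ∀ {u w} → Adj (mirror u) w → Adj u (mirror w)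
    mirror-adjˡ {u} {w} a =
      subst (λ x → Adj x (mirror w)) (mirror-involutive u) (mirror-adj a)

  module MirrorGame (S : MirrorStrategy) (p : Player) where
    open MirrorStrategy S

    q : Player
    q = opp p

    record Mirrored (pos : Position) : Set where
      field
        centre-coloured : pos centre ≡ col p
        q-answered      : ∀ {u} → pos u ≡ col q → pos (mirror u) ≡ col p
        p-answers       : ∀ {u} → pos u ≡ col p → u ≡ centre ⊎ pos (mirror u) ≡ col q

    module Reply {pos} (inv : Mirrored pos) {v} (legal : Legal q pos v) where
      open Mirrored inv

      v-uncoloured : ∀ {r} → pos (mirror (mirror v)) ≢ col r
      v-uncoloured e =
        uncol≢col (trans (sym (proj₁ legal)) (trans (sym (cong pos (mirror-involutive v))) e))

      avoids-p : ∀ {w} → Adj v w → pos w ≢ col p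
      avoids-p {w} a e = proj₂ legal w a (trans e (cong col (sym (opp-involutive p))))

      v∉N[centre] : ¬ v ∈N[ centre ]
      v∉N[centre] (inj₁ refl) = uncol≢col (trans (sym (proj₁ legal)) centre-coloured)
      v∉N[centre] (inj₂ a)    = avoids-p a centre-coloured

      mirror-v≢v : mirror v ≢ v
      mirror-v≢v e = v∉N[centre] (near-mirror⇒∈N v (inj₁ (sym e)))

      mirror-v≢centre : mirror v ≢ centre
      mirror-v≢centre e = v∉N[centre] (subst (_∈N[ centre ])
        (trans (cong mirror (sym e)) (mirror-involutive v)) mirror-centre-∈N)

      mirror-v-uncoloured : pos (mirror v) ≡ uncol
      mirror-v-uncoloured with colour-cases p (pos (mirror v))
      ... | inj₁ e        = e
      ... | inj₂ (inj₁ e) = ⊥-elim ([ mirror-v≢centre , v-uncoloured ]′ (p-answers e))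
      ... | inj₂ (inj₂ e) = ⊥-elim (v-uncoloured (q-answered e))

      pos′ : Position
      pos′ = play pos v q

      no-q-neighbour : ∀ w → Dec (w ≡ v) → Adj (mirror v) w → pos′ w ≢ col q
      no-q-neighbour w (yes refl) a _ =
        v∉N[centre] (near-mirror⇒∈N v (inj₂ (mirror-adjˡ a)))
      no-q-neighbour w (no w≢v)   a e =
        avoids-p (mirror-adjˡ a) (q-answered (trans (sym (play-other pos v q w≢v)) e))

      reply-legal : Legal p pos′ (mirror v)
      reply-legal = trans (play-other pos v q mirror-v≢v) mirror-v-uncoloured
                  , λ w → no-q-neighbour w (w ≟V v)

      pos″ : Position
      pos″ = play pos′ (mirror v) p

      pos″-v : pos″ v ≡ col q
      pos″-v = trans (play-other pos′ (mirror v) p (mirror-v≢v ∘ sym)) (play-same pos v q)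

      pos″-mirror-v : pos″ (mirror v) ≡ col p
      pos″-mirror-v = play-same pos′ (mirror v) p

      pos″-other : ∀ {u} → u ≢ v → u ≢ mirror v → pos″ u ≡ pos u
      pos″-other u≢v u≢mv =
        trans (play-other pos′ (mirror v) p u≢mv) (play-other pos v q u≢v)

      pos″-mirror-other : ∀ {u} → u ≢ v → u ≢ mirror v →
                          pos″ (mirror u) ≡ pos (mirror u)
      pos″-mirror-other {u} u≢v u≢mv = pos″-other
        (λ e → u≢mv (trans (sym (mirror-involutive u)) (cong mirror e)))
        (u≢v ∘ mirror-injective)

      answered : ∀ u → Dec (u ≡ v) → Dec (u ≡ mirror v) →
                 pos″ u ≡ col q → pos″ (mirror u) ≡ col p
      answered u (yes refl) _          _ = pos″-mirror-v
      answered u (no _)     (yes refl) e =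
        ⊥-elim (col≢col-opp p (trans (sym pos″-mirror-v) e))
      answered u (no u≢v)   (no u≢mv)  e = trans (pos″-mirror-other u≢v u≢mv)
        (q-answered (trans (sym (pos″-other u≢v u≢mv)) e))

      answers : ∀ u → Dec (u ≡ v) → Dec (u ≡ mirror v) →
                pos″ u ≡ col p → u ≡ centre ⊎ pos″ (mirror u) ≡ col q
      answers u (yes refl) _          e = ⊥-elim (col≢col-opp p (trans (sym e) pos″-v))
      answers u (no _)     (yes refl) _ =
        inj₂ (trans (cong pos″ (mirror-involutive v)) pos″-v)
      answers u (no u≢v)   (no u≢mv)  e = ⊎-map₂ (trans (pos″-mirror-other u≢v u≢mv))
        (p-answers (trans (sym (pos″-other u≢v u≢mv)) e))

      reply-mirrored : Mirrored pos″
      reply-mirrored = record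
        { centre-coloured =
            trans (pos″-other centre≢v (mirror-v≢centre ∘ sym)) centre-coloured
        ; q-answered      = λ {u} → answered u (u ≟V v) (u ≟V mirror v)
        ; p-answers       = λ {u} → answers u (u ≟V v) (u ≟V mirror v)
        }
        where
        centre≢v : centre ≢ v
        centre≢v refl = v∉N[centre] (inj₁ refl)

      reply-decreases : uncoloured vertices pos″ < uncoloured vertices pos
      reply-decreases = <-trans
        (uncoloured-play-< p (vertices-complete (mirror v)) (proj₁ reply-legal))
        (uncoloured-play-< q (vertices-complete v) (proj₁ legal))

    mirrored-lose : ∀ {pos} → Acc _<_ (uncoloured vertices pos) → Mirrored pos → Lose q pos
    mirrored-lose {pos} (acc rs) inv = lose λ v legal →
      let open Reply inv legal in
      subst (λ r → Win r pos′) (sym (opp-involutive p))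
        (win (mirror v) reply-legal (mirrored-lose (rs reply-decreases) reply-mirrored))

    pos₀ : Position
    pos₀ = play initial centre p

    only-centre-coloured : ∀ {u r} → Dec (u ≡ centre) → pos₀ u ≡ col r →
                           u ≡ centre × col p ≡ col r
    only-centre-coloured (yes refl) e = refl , trans (sym (play-same initial centre p)) e
    only-centre-coloured (no u≢c)   e =
      ⊥-elim (uncol≢col (trans (sym (play-other initial centre p u≢c)) e))

    opening-mirrored : Mirrored pos₀
    opening-mirrored = record
      { centre-coloured = play-same initial centre p
      ; q-answered      = λ {u} e →
          ⊥-elim (col≢col-opp p (proj₂ (only-centre-coloured (u ≟V centre) e)))
      ; p-answers       = λ {u} e → inj₁ (proj₁ (only-centre-coloured (u ≟V centre) e))
      }

    first-player-wins : Win p initial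
    first-player-wins =
      win centre (refl , λ _ _ ()) (mirrored-lose (<-wellFounded _) opening-mirrored)

  mirrorStrategy⇒firstPlayerWin : MirrorStrategy → FirstPlayerWin G
  mirrorStrategy⇒firstPlayerWin S = MirrorGame.first-player-wins S

open Mirror using (MirrorStrategy; mirrorStrategy⇒firstPlayerWin)

record _≅_ (G H : Graph) : Set where
  field
    vertexIso : Graph.V G ↔ Graph.V H
  open Inverse vertexIso public
  field
    adj⇒ : ∀ {u v} → Graph.Adj G u v → Graph.Adj H (to u) (to v)
    adj⇐ : ∀ {u v} → Graph.Adj H (to u) (to v) → Graph.Adj G u v

mirrorStrategy-≅ : ∀ {G H} → G ≅ H → MirrorStrategy H → MirrorStrategy G
mirrorStrategy-≅ {G} {H} iso S = record
  { centre            = from S.centre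
  ; mirror            = mirror
  ; mirror-involutive = mirror-involutive
  ; mirror-adj        = from-adj ∘ S.mirror-adj ∘ adj⇒
  ; near-mirror⇒∈N    = λ v → subst (_∈N[ from S.centre ]) (strictlyInverseʳ v)
                              ∘ from-∈N ∘ S.near-mirror⇒∈N (to v) ∘ to-near-mirror v
  ; mirror-centre-∈N  = subst (λ c → from (S.mirror c) ∈N[ from S.centre ])
                              (sym (strictlyInverseˡ S.centre)) (from-∈N S.mirror-centre-∈N)
  ; vertices          = map from S.vertices
  ; vertices-complete = λ v → subst (_∈ map from S.vertices) (strictlyInverseʳ v)
                              (∈-map⁺ from (S.vertices-complete (to v)))
  }
  where
  open _≅_ iso
  module S = MirrorStrategy S
  module G = Graph G
  module H = Graph H
  open Mirror G using (_∈N[_])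
  open Mirror H using () renaming (_∈N[_] to _∈ᴴN[_])

  mirror : G.V → G.V
  mirror v = from (S.mirror (to v))

  mirror-involutive : ∀ v → mirror (mirror v) ≡ v
  mirror-involutive v = begin
    from (S.mirror (to (from (S.mirror (to v))))) ≡⟨ cong (from ∘ S.mirror) (strictlyInverseˡ _) ⟩
    from (S.mirror (S.mirror (to v)))            ≡⟨ cong from (S.mirror-involutive (to v)) ⟩
    from (to v)                                  ≡⟨ strictlyInverseʳ v ⟩
    v                                            ∎
    where open ≡-Reasoning

  from-adj : ∀ {x y} → H.Adj x y → G.Adj (from x) (from y)
  from-adj {x} {y} a =
    adj⇐ (subst₂ H.Adj (sym (strictlyInverseˡ x)) (sym (strictlyInverseˡ y)) a)

  from-∈N : ∀ {x c} → x ∈ᴴN[ c ] → from x ∈N[ from c ]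
  from-∈N = ⊎-map (cong from) from-adj

  to-near-mirror : ∀ v → v ≡ mirror v ⊎ G.Adj v (mirror v) →
                   to v ≡ S.mirror (to v) ⊎ H.Adj (to v) (S.mirror (to v))
  to-near-mirror v = ⊎-map (λ e → trans (cong to e) (strictlyInverseˡ _))
                           (subst (H.Adj (to v)) (strictlyInverseˡ _) ∘ adj⇒)

-- Squares of paths

PathSquareEdge : ℕ → ℕ → Set
PathSquareEdge a b = b ≡ 1 + a ⊎ b ≡ 2 + a

PathSquareAdj : ℕ → ℕ → Set
PathSquareAdj a b = PathSquareEdge a b ⊎ PathSquareEdge b a

PathSquare : ℕ → Graph
PathSquare N = record
  { V    = Fin N
  ; _≟V_ = _≟ᶠ_
  ; Adj  = λ i j → PathSquareAdj (toℕ i) (toℕ j)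
  }

MirrorPair : ℕ → ℕ → ℕ → Set
MirrorPair N a b = suc (a + b) ≡ N

MirrorPair-sym : ∀ {N a b} → MirrorPair N a b → MirrorPair N b a
MirrorPair-sym {a = a} {b} = trans (cong suc (+-comm b a))

toℕ-opposite : ∀ {n} (i : Fin n) → MirrorPair n (toℕ i) (toℕ (opposite i))
toℕ-opposite {n} i = begin
  suc (toℕ i + toℕ (opposite i)) ≡⟨ cong suc (+-comm (toℕ i) _) ⟩
  suc (toℕ (opposite i) + toℕ i) ≡⟨ sym (+-suc _ (toℕ i)) ⟩
  toℕ (opposite i) + suc (toℕ i) ≡⟨ cong (_+ suc (toℕ i)) (opposite-prop i) ⟩
  n ∸ suc (toℕ i) + suc (toℕ i)  ≡⟨ m∸n+n≡m (toℕ<n i) ⟩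
  n                              ∎
  where open ≡-Reasoning

MirrorPair-shift : ∀ {N a a′ b b′ k} → MirrorPair N a a′ → MirrorPair N b b′ →
                   b ≡ k + a → a′ ≡ k + b′
MirrorPair-shift {a = a} {a′} {b′ = b′} {k} ma mb refl =
  +-cancelˡ-≡ a a′ (k + b′) (begin
    a + a′       ≡⟨ suc-injective (trans ma (sym mb)) ⟩
    k + a + b′   ≡⟨ cong (_+ b′) (+-comm k a) ⟩
    a + k + b′   ≡⟨ +-assoc a k b′ ⟩
    a + (k + b′) ∎)
  where open ≡-Reasoning

edge-reflect : ∀ {N a a′ b b′} → MirrorPair N a a′ → MirrorPair N b b′ →
               PathSquareEdge a b → PathSquareEdge b′ a′
edge-reflect ma mb = ⊎-map (MirrorPair-shift ma mb) (MirrorPair-shift ma mb)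

adj-reflect : ∀ {N a a′ b b′} → MirrorPair N a a′ → MirrorPair N b b′ →
              PathSquareAdj a b → PathSquareAdj a′ b′
adj-reflect ma mb = ⊎-swap ∘ ⊎-map (edge-reflect ma mb) (edge-reflect mb ma)

near-mirror⇒near-half : ∀ {N a b} → MirrorPair N a b → a ≡ b ⊎ PathSquareAdj a b →
                        a ≡ ⌊ N /2⌋ ⊎ PathSquareAdj a ⌊ N /2⌋
near-mirror⇒near-half {a = a} refl (inj₁ refl) = inj₁ (n≡⌈n+n/2⌉ a)
near-mirror⇒near-half {a = a} refl (inj₂ (inj₁ (inj₁ refl))) = inj₂ (inj₁ (inj₁ (begin
  ⌊ suc (a + suc a) /2⌋ ≡⟨ cong (⌊_/2⌋ ∘ suc) (+-suc a a) ⟩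
  suc ⌊ a + a /2⌋       ≡⟨ cong suc (sym (n≡⌊n+n/2⌋ a)) ⟩
  suc a                 ∎)))
  where open ≡-Reasoning
near-mirror⇒near-half {a = a} refl (inj₂ (inj₁ (inj₂ refl))) = inj₂ (inj₁ (inj₁ (begin
  ⌊ suc (a + suc (suc a)) /2⌋ ≡⟨ cong (⌊_/2⌋ ∘ suc) (+-suc a (suc a)) ⟩
  ⌊ suc (suc (a + suc a)) /2⌋ ≡⟨ cong (⌈_/2⌉ ∘ suc) (+-suc a a) ⟩
  suc ⌈ a + a /2⌉             ≡⟨ cong suc (sym (n≡⌈n+n/2⌉ a)) ⟩
  suc a                       ∎)))
  where open ≡-Reasoning
near-mirror⇒near-half {b = b} refl (inj₂ (inj₂ (inj₁ refl))) =
  inj₁ (cong suc (n≡⌊n+n/2⌋ b))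
near-mirror⇒near-half {b = b} refl (inj₂ (inj₂ (inj₂ refl))) =
  inj₂ (inj₂ (inj₁ (cong (2 +_) (n≡⌈n+n/2⌉ b))))

⌈n/2⌉-cases : ∀ n → ⌈ n /2⌉ ≡ ⌊ n /2⌋ ⊎ ⌈ n /2⌉ ≡ 1 + ⌊ n /2⌋
⌈n/2⌉-cases zero          = inj₁ refl
⌈n/2⌉-cases (suc zero)    = inj₂ refl
⌈n/2⌉-cases (suc (suc n)) = ⊎-map (cong suc) (cong suc) (⌈n/2⌉-cases n)

mirror-of-half⇒near-half : ∀ {N b} → MirrorPair N ⌊ N /2⌋ b →
                           b ≡ ⌊ N /2⌋ ⊎ PathSquareAdj b ⌊ N /2⌋
mirror-of-half⇒near-half {N} {b} m =
  [ (λ e → inj₂ (inj₁ (inj₁ (sym (trans 1+b≡⌈N/2⌉ e)))))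
  , (λ e → inj₁ (suc-injective (trans 1+b≡⌈N/2⌉ e)))
  ]′ (⌈n/2⌉-cases N)
  where
  1+b≡⌈N/2⌉ : suc b ≡ ⌈ N /2⌉
  1+b≡⌈N/2⌉ = +-cancelˡ-≡ ⌊ N /2⌋ (suc b) ⌈ N /2⌉
                (trans (+-suc ⌊ N /2⌋ b) (trans m (sym (⌊n/2⌋+⌈n/2⌉≡n N))))

pathSquare-mirrorStrategy : ∀ M → MirrorStrategy (PathSquare (suc M))
pathSquare-mirrorStrategy M = record
  { centre            = centre
  ; mirror            = opposite
  ; mirror-involutive = opposite-involutive
  ; mirror-adj        = λ {i} {j} → adj-reflect (toℕ-opposite i) (toℕ-opposite j)
  ; near-mirror⇒∈N    = λ i → near-half⇒∈N
                              ∘ near-mirror⇒near-half (toℕ-opposite i)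
                              ∘ ⊎-map₁ (cong toℕ)
  ; mirror-centre-∈N  = near-half⇒∈N (mirror-of-half⇒near-half
      (subst (λ c → MirrorPair (suc M) c (toℕ (opposite centre))) toℕ-centre
             (toℕ-opposite centre)))
  ; vertices          = allFin (suc M)
  ; vertices-complete = ∈-allFin
  }
  where
  open Mirror (PathSquare (suc M)) using (_∈N[_])

  centre : Fin (suc M)
  centre = fromℕ< (⌊n/2⌋<n M)

  toℕ-centre : toℕ centre ≡ ⌊ suc M /2⌋
  toℕ-centre = toℕ-fromℕ< (⌊n/2⌋<n M)

  near-half⇒∈N : ∀ {i} → toℕ i ≡ ⌊ suc M /2⌋ ⊎ PathSquareAdj (toℕ i) ⌊ suc M /2⌋ →
                 i ∈N[ centre ]
  near-half⇒∈N = ⊎-map (λ e → toℕ-injective (trans e (sym toℕ-centre)))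
                       (subst (PathSquareAdj _) (sym toℕ-centre))

≅PathSquare⇒firstPlayerWin : ∀ {G} M → G ≅ PathSquare (suc M) → FirstPlayerWin G
≅PathSquare⇒firstPlayerWin {G} M iso =
  mirrorStrategy⇒firstPlayerWin G (mirrorStrategy-≅ iso (pathSquare-mirrorStrategy M))

rank-≅PathSquare : ∀ {G N} (f : Graph.V G ↔ Fin N) (rank : Graph.V G → ℕ) →
  (∀ v → toℕ (Inverse.to f v) ≡ rank v) →
  (∀ {u v} → Graph.Adj G u v → PathSquareAdj (rank u) (rank v)) →
  (∀ {u v} → PathSquareAdj (rank u) (rank v) → Graph.Adj G u v) →
  G ≅ PathSquare N
rank-≅PathSquare f rank toℕ-to≡rank adj⇒ adj⇐ = record
  { vertexIso = f
  ; adj⇒      = λ {u} {v} →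
      subst₂ PathSquareAdj (sym (toℕ-to≡rank u)) (sym (toℕ-to≡rank v)) ∘ adj⇒
  ; adj⇐      = λ {u} {v} →
      adj⇐ ∘ subst₂ PathSquareAdj (toℕ-to≡rank u) (toℕ-to≡rank v)
  }

-- The ladders T_{n,2} and T_{n,2}⁺

bit+double-injective : ∀ a b (j k : Fin 2) →
                       toℕ j + 2 * a ≡ toℕ k + 2 * b → j ≡ k × a ≡ b
bit+double-injective a b zero       zero       e = refl , *-cancelˡ-≡ a b 2 e
bit+double-injective a b zero       (suc zero) e = ⊥-elim (even≢odd a b e)
bit+double-injective a b (suc zero) zero       e = ⊥-elim (even≢odd b a (sym e))
bit+double-injective a b (suc zero) (suc zero) e = refl , *-cancelˡ-≡ a b 2 (suc-injective e)

module _ {n : ℕ} where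

  opposite-shift : ∀ {k} {i i′ : Fin n} →
                   toℕ i′ ≡ k + toℕ i → toℕ (opposite i) ≡ k + toℕ (opposite i′)
  opposite-shift {k} {i} {i′} =
    MirrorPair-shift {a = toℕ i} {toℕ (opposite i)} {toℕ i′} {toℕ (opposite i′)} {k}
      (toℕ-opposite i) (toℕ-opposite i′)

  opposite-shift⁻¹ : ∀ {k} {i i′ : Fin n} →
                     toℕ (opposite i′) ≡ k + toℕ (opposite i) → toℕ i ≡ k + toℕ i′
  opposite-shift⁻¹ {k} {i} {i′} =
    MirrorPair-shift {a = toℕ (opposite i)} {toℕ i} {toℕ (opposite i′)} {toℕ i′} {k}
      (MirrorPair-sym {a = toℕ i} (toℕ-opposite i))
      (MirrorPair-sym {a = toℕ i′} (toℕ-opposite i′))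

  double-opposite-shift : ∀ {i i′ : Fin n} → toℕ i′ ≡ 1 + toℕ i →
                          2 * toℕ (opposite i) ≡ 2 + 2 * toℕ (opposite i′)
  double-opposite-shift e = trans (cong (2 *_) (opposite-shift e)) (*-suc 2 _)

  last⇒toℕ-opposite≡0 : ∀ {i : Fin n} → suc (toℕ i) ≡ n → toℕ (opposite i) ≡ 0
  last⇒toℕ-opposite≡0 {i} e = +-cancelˡ-≡ (toℕ i) _ 0 (suc-injective
    (trans (toℕ-opposite i) (trans (sym e) (cong suc (sym (+-identityʳ (toℕ i)))))))

  toℕ-opposite≡0⇒last : ∀ {i : Fin n} → toℕ (opposite i) ≡ 0 → suc (toℕ i) ≡ n
  toℕ-opposite≡0⇒last {i} e =
    trans (cong suc (sym (trans (cong (toℕ i +_) e) (+-identityʳ (toℕ i))))) (toℕ-opposite i)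

  -- Vertex (i, j) (0-based) gets number 2(n-1-i) + j.
  zigzag : Fin n × Fin 2 → Fin (n * 2)
  zigzag (i , j) = combine (opposite i) j

  unzigzag : Fin (n * 2) → Fin n × Fin 2
  unzigzag k = map₁ opposite (remQuot {n} 2 k)

  zigzag-↔ : (Fin n × Fin 2) ↔ Fin (n * 2)
  zigzag-↔ = mk↔ₛ′ zigzag unzigzag zigzag-unzigzag unzigzag-zigzag
    where
    open ≡-Reasoning
    zigzag-unzigzag : ∀ k → zigzag (unzigzag k) ≡ k
    zigzag-unzigzag k = trans
      (cong (λ i → combine i (proj₂ r)) (opposite-involutive (proj₁ r)))
      (combine-remQuot {n} 2 k)
      where r = remQuot {n} 2 k
    unzigzag-zigzag : ∀ v → unzigzag (zigzag v) ≡ v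
    unzigzag-zigzag (i , j) = begin
      map₁ opposite (remQuot 2 (combine (opposite i) j))
        ≡⟨ cong (map₁ opposite) (remQuot-combine (opposite i) j) ⟩
      (opposite (opposite i) , j)
        ≡⟨ cong (_, j) (opposite-involutive i) ⟩
      (i , j)
        ∎

  rank : Fin n × Fin 2 → ℕ
  rank (i , j) = toℕ j + 2 * toℕ (opposite i)

  toℕ-zigzag : ∀ v → toℕ (zigzag v) ≡ rank v
  toℕ-zigzag (i , j) =
    trans (toℕ-combine (opposite i) j) (+-comm (2 * toℕ (opposite i)) (toℕ j))

  TEdge⇒adj : ∀ {u v} → TEdge u v → PathSquareAdj (rank u) (rank v)
  TEdge⇒adj {_ , zero}     {_ , zero}     (inj₁ (e , _))           =
    inj₂ (inj₂ (double-opposite-shift e))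
  TEdge⇒adj {_ , suc zero} {_ , suc zero} (inj₁ (e , _))           =
    inj₂ (inj₂ (cong suc (double-opposite-shift e)))
  TEdge⇒adj {_ , zero}     {_ , suc zero} (inj₂ (inj₁ (refl , _))) = inj₁ (inj₁ refl)
  TEdge⇒adj {_ , zero}     {_ , suc zero} (inj₂ (inj₂ (e , _)))    =
    inj₂ (inj₁ (double-opposite-shift e))
  TEdge⇒adj {_ , zero}     {_ , zero}     (inj₂ (inj₁ (_ , ())))
  TEdge⇒adj {_ , zero}     {_ , zero}     (inj₂ (inj₂ (_ , ())))
  TEdge⇒adj {_ , suc zero} {_ , zero}     (inj₂ (inj₁ (_ , ())))
  TEdge⇒adj {_ , suc zero} {_ , zero}     (inj₂ (inj₂ (_ , ())))
  TEdge⇒adj {_ , suc zero} {_ , suc zero} (inj₂ (inj₁ (_ , ())))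
  TEdge⇒adj {_ , suc zero} {_ , suc zero} (inj₂ (inj₂ (_ , ())))

  rank-decode : ∀ {i j} (k : Fin 2) b → rank (i , j) ≡ toℕ k + 2 * b →
                j ≡ k × toℕ (opposite i) ≡ b
  rank-decode {i} {j} k b = bit+double-injective (toℕ (opposite i)) b j k

  edge⇒TAdj : ∀ {u v} → PathSquareEdge (rank u) (rank v) → Graph.Adj (T n 2) u v
  edge⇒TAdj {i , zero} {i′ , j′} (inj₁ e)
    with refl , o′≡o ← rank-decode {i′} {j′} (suc zero) (toℕ (opposite i)) e
    = inj₁ (inj₂ (inj₁ (toℕ-injective (opposite-shift⁻¹ {k = 0} {i} o′≡o) , refl)))
  edge⇒TAdj {i , suc zero} {i′ , j′} (inj₁ e)
    with refl , o′≡1+o ← rank-decode {i′} {j′} zero (suc (toℕ (opposite i)))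
                           (trans e (sym (*-suc 2 (toℕ (opposite i)))))
    = inj₂ (inj₂ (inj₂ (opposite-shift⁻¹ {i = i} o′≡1+o , refl)))
  edge⇒TAdj {i , zero} {i′ , j′} (inj₂ e)
    with refl , o′≡1+o ← rank-decode {i′} {j′} zero (suc (toℕ (opposite i)))
                           (trans e (sym (*-suc 2 (toℕ (opposite i)))))
    = inj₂ (inj₁ (opposite-shift⁻¹ {i = i} o′≡1+o , refl))
  edge⇒TAdj {i , suc zero} {i′ , j′} (inj₂ e)
    with refl , o′≡1+o ← rank-decode {i′} {j′} (suc zero) (suc (toℕ (opposite i)))
                           (trans e (cong suc (sym (*-suc 2 (toℕ (opposite i))))))
    = inj₂ (inj₁ (opposite-shift⁻¹ {i = i} o′≡1+o , refl))

  T≅PathSquare : T n 2 ≅ PathSquare (n * 2)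
  T≅PathSquare = rank-≅PathSquare zigzag-↔ rank toℕ-zigzag
    [ TEdge⇒adj , ⊎-swap ∘ TEdge⇒adj ]′
    [ edge⇒TAdj , ⊎-swap ∘ edge⇒TAdj ]′

  -- R₂ gets number 0; the last rung is shifted to the numbers 1 and 2.
  zigzag⁺-↔ : Maybe (Fin n × Fin 2) ↔ Fin (suc (n * 2))
  zigzag⁺-↔ = mk↔ₛ′ to from to-from from-to
    where
    to : Maybe (Fin n × Fin 2) → Fin (suc (n * 2))
    to nothing  = zero
    to (just v) = suc (zigzag v)
    from : Fin (suc (n * 2)) → Maybe (Fin n × Fin 2)
    from zero    = nothing
    from (suc k) = just (unzigzag k)
    to-from : ∀ k → to (from k) ≡ k
    to-from zero    = refl
    to-from (suc k) = cong suc (Inverse.strictlyInverseˡ zigzag-↔ k)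
    from-to : ∀ v → from (to v) ≡ v
    from-to nothing  = refl
    from-to (just v) = cong just (Inverse.strictlyInverseʳ zigzag-↔ v)

  rank⁺ : Maybe (Fin n × Fin 2) → ℕ
  rank⁺ nothing  = 0
  rank⁺ (just v) = suc (rank v)

  toℕ-zigzag⁺ : ∀ v → toℕ (Inverse.to zigzag⁺-↔ v) ≡ rank⁺ v
  toℕ-zigzag⁺ nothing  = refl
  toℕ-zigzag⁺ (just v) = cong suc (toℕ-zigzag v)

  edge-suc : ∀ {a b} → PathSquareEdge a b → PathSquareEdge (suc a) (suc b)
  edge-suc = ⊎-map (cong suc) (cong suc)

  TPlusEdge⇒adj : ∀ {u v} → TPlusEdge n u v → PathSquareAdj (rank⁺ u) (rank⁺ v)
  TPlusEdge⇒adj {just _}              {just _}  e = ⊎-map edge-suc edge-suc (TEdge⇒adj e)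
  TPlusEdge⇒adj {just (_ , zero)}     {nothing} e =
    inj₂ (inj₁ (cong (λ o → suc (2 * o)) (last⇒toℕ-opposite≡0 e)))
  TPlusEdge⇒adj {just (_ , suc zero)} {nothing} e =
    inj₂ (inj₂ (cong (λ o → 2 + 2 * o) (last⇒toℕ-opposite≡0 e)))

  edge⇒TPlusAdj : ∀ {u v} → PathSquareEdge (rank⁺ u) (rank⁺ v) → Graph.Adj (TPlus n) u v
  edge⇒TPlusAdj {just _}  {just _}       e = edge⇒TAdj (⊎-map suc-injective suc-injective e)
  edge⇒TPlusAdj {nothing} {just (i , j)} (inj₁ e) =
    inj₂ (toℕ-opposite≡0⇒last (proj₂ (rank-decode {i} {j} zero 0 (suc-injective e))))
  edge⇒TPlusAdj {nothing} {just (i , j)} (inj₂ e) =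
    inj₂ (toℕ-opposite≡0⇒last (proj₂ (rank-decode {i} {j} (suc zero) 0 (suc-injective e))))
  edge⇒TPlusAdj {just _}  {nothing} (inj₁ ())
  edge⇒TPlusAdj {just _}  {nothing} (inj₂ ())
  edge⇒TPlusAdj {nothing} {nothing} (inj₁ ())
  edge⇒TPlusAdj {nothing} {nothing} (inj₂ ())

  TPlus≅PathSquare : TPlus n ≅ PathSquare (suc (n * 2))
  TPlus≅PathSquare = rank-≅PathSquare zigzag⁺-↔ rank⁺ toℕ-zigzag⁺
    [ TPlusEdge⇒adj , ⊎-swap ∘ TPlusEdge⇒adj ]′
    [ edge⇒TPlusAdj , ⊎-swap ∘ edge⇒TPlusAdj ]′

proposition2p1 : ∀ (n : ℕ) → n ≥ 1 →
    FirstPlayerWin (T n 2) × FirstPlayerWin (TPlus n)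
proposition2p1 (suc m) _ = ≅PathSquare⇒firstPlayerWin (suc (m * 2)) T≅PathSquare
                         , ≅PathSquare⇒firstPlayerWin (suc (suc (m * 2))) TPlus≅PathSquare
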